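{- Let $h\ge 3$, $q=2^h$, let $\lambda$ be a primitive element of $\mathbb{F}_q$, and let $\ell=\mathrm{PG}(1,q)$. Let $$\mathcal{C}=\{\langle(t_1\lambda+t_2\lambda^2+\dots+t_{h-1}\lambda^{h-1},\ t_{h-1}+t_h\lambda)\rangle_{\mathbb{F}_q}: t_i\in\mathbb{F}_2,\ (t_1,\dots,t_h)\neq(0,\dots,0)\}\subseteq\ell,$$ an $\mathbb{F}_2$-linear $(h-2)$-club of rank $h$ with head $(1,0)$. Then $(\ell\setminus\mathcal{C})\cup\{(1,0)\}$ is an $\mathbb{F}_2$-linear set.
   Context: An $\mathbb{F}_2$-linear set of rank $k$ in $\mathrm{PG}(1,2^h)$ is the set of points $\{\langle w\rangle_{\mathbb{F}_{2^h}}: w\in W\setminus\{0\}\}$ for some $k$-dimensional $\mathbb{F}_2$-subspace $W$ of $\mathbb{F}_{2^h}^2$; the weight of a point $\langle v\rangle$ is $\dim_{\mathbb{F}_2}(W\cap\langle v\rangle_{\mathbb{F}_{2^h}})$. An $i$-club of rank $k$ is such a linear set with one point (the head) of weight $i$ and all others of weight $1$. -}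

module Defs where

open import Level using (Level; suc; _⊔_) renaming (zero to lzero)
open import Data.Nat as ℕ using (ℕ; _∸_; _<?_)
open import Data.Fin using (Fin; fromℕ<)
open import Data.Bool using (Bool; true; false; if_then_else_)
open import Data.Product using (Σ; ∃; ∃-syntax; _×_; _,_)
open import Data.Sum using (_⊎_)
open import Relation.Binary.PropositionalEquality using (_≡_; _≢_)
open import Relation.Nullary using (¬_; yes; no)
open import Algebra.Structures using (IsCommutativeRing)
open import Function.Bundles using (_↔_; _⇔_)

record Field : Set₁ where
  infixl 7 _*_
  infixl 6 _+_
  field
    Carrier : Set
    _+_ _*_ : Carrier → Carrier → Carrier
    -_ : Carrier → Carrier
    0# 1# : Carrier
    isCommutativeRing : IsCommutativeRing _≡_ _+_ _*_ -_ 0# 1#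
    0≢1 : 0# ≢ 1#
    inverse : ∀ x → x ≢ 0# → ∃[ y ] (x * y ≡ 1#)

  _^_ : Carrier → ℕ → Carrier
  x ^ ℕ.zero = 1#
  x ^ ℕ.suc n = x * (x ^ n)

  ι : Bool → Carrier
  ι true = 1#
  ι false = 0#

HasOrder : Field → ℕ → Set
HasOrder F q = Field.Carrier F ↔ Fin q

IsPrimitive : (F : Field) → Field.Carrier F → Set
IsPrimitive F λ′ = (λ′ ≢ 0#) × (∀ x → x ≢ 0# → ∃[ n ] (x ≡ λ′ ^ n))
  where open Field F

module Geometry (F : Field) where
  open Field F

  V : Set
  V = Carrier × Carrier

  zeroV : V
  zeroV = 0# , 0#

  _⊕_ : V → V → V
  (a , b) ⊕ (c , d) = (a + c) , (b + d)

  _·_ : Carrier → V → V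
  μ · (a , b) = (μ * a) , (μ * b)

  -- ⟨v⟩ = ⟨w⟩ as points of PG(1,q) (for nonzero v, w): v is an F_q-multiple of w
  SamePoint : V → V → Set
  SamePoint v w = ∃[ μ ] (μ ≢ 0# × v ≡ μ · w)

  -- an F_2-subspace of F_q^2 (as a predicate): contains 0, closed under addition
  -- (scalar multiplication by F_2 = {0,1} is then automatic)
  record F2Subspace : Set₁ where
    field
      mem : V → Set
      mem-zero : mem zeroV
      mem-+ : ∀ {v w} → mem v → mem w → mem (v ⊕ w)

  -- a set of points of ℓ = PG(1,q), represented as a predicate on nonzero vectors
  -- the point ⟨v⟩ lies in the F_2-linear set L_W
  InLinearSet : F2Subspace → V → Set
  InLinearSet W v = ∃[ w ] (F2Subspace.mem W w × w ≢ zeroV × SamePoint v w)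

  IsF2Linear : (V → Set) → Set₁
  IsF2Linear S = ∃[ W ] (∀ v → v ≢ zeroV → (InLinearSet W v ⇔ S v))

  sumFrom1 : ℕ → (ℕ → Carrier) → Carrier
  sumFrom1 ℕ.zero f = 0#
  sumFrom1 (ℕ.suc n) f = sumFrom1 n f + f (ℕ.suc n)

-- t_i for t = (t_1,...,t_h) given as t : Fin h → Bool (t_i = t (i-1)); false out of range
coord : {h : ℕ} → (Fin h → Bool) → ℕ → Bool
coord {h} t ℕ.zero = false
coord {h} t (ℕ.suc j) with j <? h
... | yes p = t (fromℕ< p)
... | no _ = false

NonzeroTuple : {h : ℕ} → (Fin h → Bool) → Set
NonzeroTuple {h} t = ∃[ i ] (t i ≡ true)

module Club (F : Field) (h : ℕ) (λ′ : Field.Carrier F) where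
  open Field F
  open Geometry F

  clubVec : (Fin h → Bool) → V
  clubVec t = sumFrom1 (h ∸ 1) (λ i → ι (coord t i) * (λ′ ^ i))
            , (ι (coord t (h ∸ 1)) + ι (coord t h) * λ′)

  InC : V → Set
  InC v = ∃[ t ] (NonzeroTuple {h} t × SamePoint v (clubVec t))

  Complement∪Head : V → Set
  Complement∪Head v = (¬ InC v) ⊎ SamePoint v (1# , 0#)

module Submission where

-- In a field F of order 2^h with primitive element g we first establish
-- characteristic two (Fermat: x ↑ 2^h ≡ x, applied to -1) and then that 1, g, …, g^(h-1)
-- is an F₂-basis of F: a monic relation g^d = Σ_{i<d} m_i g^i makes every power of g,
-- hence every element, a combination of lower powers, so 2^h ≤ 2^d by counting, while a
-- relation of degree ≤ h exists by pigeonhole.  This yields a coordinate map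
-- co : F → (ℕ → Bool) that is additive, and (g x)₀ = x_{h-1} because m₀ = 1.
-- For the club we work with φ₀ x = x₀, φ₁ x = x_{h-1}, φ₂ x = (g x)_{h-1}: an affine
-- point ⟨(x , 1)⟩ lies on 𝒞 iff β x has coordinates x₀ = 0, x_{h-1} = p for one of the
-- slopes β = ι p + ι r g ∈ {1, g, 1 + g}, and a truth table shows that this fails
-- exactly when φ₀ x = φ₂ x = 1.  So (ℓ ∖ 𝒞) ∪ {⟨(1,0)⟩} = L_W with
-- W = {(a , ι s) : φ₀ a = φ₂ a = s}, the head coming from the vectors with s = 0.
-- The modules below follow this order: field arithmetic, finite fields, Fermat,
-- encodings of bit sequences, F₂-combinations of powers, the power basis, points of
-- the line, and finally the club.

open import Defs
open import Data.Nat as ℕ using (ℕ; zero; suc; _≤_; _<_; _^_; z≤n; s≤s)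
import Data.Nat.Properties as ℕ
open import Data.Nat.DivMod using (_%_; _/_; m%n<n; m≡m%n+[m/n]*n)
open import Data.Fin as Fin using (Fin; toℕ; fromℕ<)
import Data.Fin.Properties as Fin
open import Data.Product using (∃₂; ∃-syntax; _×_; _,_; proj₁; proj₂)
open import Data.Empty using (⊥; ⊥-elim)
open import Data.Bool using (Bool; true; false; _xor_; _∧_; _∨_; if_then_else_)
open import Data.Bool.Properties using (¬-not; not-¬; ∧-identityʳ; ∧-zeroʳ; ∨-identityʳ; xor-same)
open import Data.Sum using (_⊎_; inj₁; inj₂; [_,_]′)
open import Relation.Binary.PropositionalEquality
open import Relation.Nullary using (Dec; yes; no; ¬_; does)
open import Relation.Nullary.Decidable using (dec-true; dec-false)
open import Function.Base using (id; case_of_)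
open import Function.Bundles using (_↔_; Inverse; Injection; mk⇔)
open import Function.Properties.Inverse using (↔⇒↣; ↔-sym)
open import Algebra.Bundles using (CommutativeRing)
import Algebra.Properties.Ring as RingProperties

module FieldArithmetic (F : Field) where
  open Field F renaming (_^_ to _↑_)

  commutativeRing : CommutativeRing _ _
  commutativeRing = record { isCommutativeRing = isCommutativeRing }

  open CommutativeRing commutativeRing public
    using ( +-assoc; *-assoc; *-comm; +-identityˡ; +-identityʳ; *-identityˡ; *-identityʳ
          ; zeroˡ; zeroʳ; distribˡ; -‿inverseʳ; ring; commutativeSemiring )
  open import Algebra.Solver.Ring.NaturalCoefficients.Default commutativeSemiring public
  import Algebra.Properties.CommutativeSemiring.Exp commutativeSemiring as Exp

  inv : (x : Carrier) → x ≢ 0# → Carrier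
  inv x x≢0 = proj₁ (inverse x x≢0)

  *-inverseʳ : ∀ x (x≢0 : x ≢ 0#) → x * inv x x≢0 ≡ 1#
  *-inverseʳ x x≢0 = proj₂ (inverse x x≢0)

  inv-*-cancel : ∀ x (x≢0 : x ≢ 0#) y → inv x x≢0 * (x * y) ≡ y
  inv-*-cancel x x≢0 y = begin
      inv x x≢0 * (x * y)  ≡⟨ sym (*-assoc _ x y) ⟩
      (inv x x≢0 * x) * y  ≡⟨ cong (_* y) (trans (*-comm _ x) (*-inverseʳ x x≢0)) ⟩
      1# * y               ≡⟨ *-identityˡ y ⟩
      y                    ∎
    where open ≡-Reasoning

  *-cancelˡ : ∀ {x a b} → x ≢ 0# → x * a ≡ x * b → a ≡ b
  *-cancelˡ {x} {a} {b} x≢0 xa≡xb = begin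
      a                     ≡⟨ sym (inv-*-cancel x x≢0 a) ⟩
      inv x x≢0 * (x * a)   ≡⟨ cong (inv x x≢0 *_) xa≡xb ⟩
      inv x x≢0 * (x * b)   ≡⟨ inv-*-cancel x x≢0 b ⟩
      b                     ∎
    where open ≡-Reasoning

  *-nonzero : ∀ {x y} → x ≢ 0# → y ≢ 0# → x * y ≢ 0#
  *-nonzero {x} {y} x≢0 y≢0 xy≡0 = y≢0 (*-cancelˡ x≢0 (trans xy≡0 (sym (zeroʳ x))))

  inv-nonzero : ∀ x (x≢0 : x ≢ 0#) → inv x x≢0 ≢ 0#
  inv-nonzero x x≢0 x⁻¹≡0 = 0≢1 (begin
      0#               ≡⟨ sym (zeroʳ x) ⟩
      x * 0#           ≡⟨ cong (x *_) (sym x⁻¹≡0) ⟩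
      x * inv x x≢0    ≡⟨ *-inverseʳ x x≢0 ⟩
      1#               ∎)
    where open ≡-Reasoning

  ↑≡^ : ∀ x n → x ↑ n ≡ x Exp.^ n
  ↑≡^ x zero = refl
  ↑≡^ x (suc n) = cong (x *_) (↑≡^ x n)

  ↑-+ : ∀ x m n → x ↑ (m ℕ.+ n) ≡ x ↑ m * x ↑ n
  ↑-+ x m n = trans (↑≡^ x (m ℕ.+ n)) (trans (Exp.^-homo-* x m n) (sym (cong₂ _*_ (↑≡^ x m) (↑≡^ x n))))

  ↑-* : ∀ x m n → (x ↑ m) ↑ n ≡ x ↑ (m ℕ.* n)
  ↑-* x m n = begin
      (x ↑ m) ↑ n        ≡⟨ ↑≡^ (x ↑ m) n ⟩
      (x ↑ m) Exp.^ n    ≡⟨ cong (Exp._^ n) (↑≡^ x m) ⟩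
      (x Exp.^ m) Exp.^ n ≡⟨ Exp.^-assocʳ x m n ⟩
      x Exp.^ (m ℕ.* n)  ≡⟨ sym (↑≡^ x (m ℕ.* n)) ⟩
      x ↑ (m ℕ.* n)      ∎
    where open ≡-Reasoning

  1↑n : ∀ n → 1# ↑ n ≡ 1#
  1↑n zero = refl
  1↑n (suc n) = trans (*-identityˡ _) (1↑n n)

  ↑-nonzero : ∀ {x} → x ≢ 0# → ∀ n → x ↑ n ≢ 0#
  ↑-nonzero x≢0 zero 1≡0 = 0≢1 (sym 1≡0)
  ↑-nonzero x≢0 (suc n) = *-nonzero x≢0 (↑-nonzero x≢0 n)

module FiniteField (F : Field) {N : ℕ} (ord : Field.Carrier F ↔ Fin N) where
  open Field F
  open Inverse ord using (to; from)

  to-injective : ∀ {x y} → to x ≡ to y → x ≡ y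
  to-injective = Injection.injective (↔⇒↣ ord)

  _≟_ : (x y : Carrier) → Dec (x ≡ y)
  x ≟ y with to x Fin.≟ to y
  ... | yes tx≡ty = yes (to-injective tx≡ty)
  ... | no tx≢ty = no (λ x≡y → tx≢ty (cong to x≡y))

  injection⇒≤ : ∀ {m} (f : Carrier → Fin m) → (∀ {x y} → f x ≡ f y → x ≡ y) → N ≤ m
  injection⇒≤ f f-inj = Fin.injective⇒≤ {f = λ i → f (from i)} (λ fi≡fj →
    Injection.injective (↔⇒↣ (↔-sym ord)) (f-inj fi≡fj))

  pigeonhole : ∀ {m} → N < m → (f : Fin m → Carrier) → ∃₂ λ i j → i Fin.< j × f i ≡ f j
  pigeonhole N<m f with Fin.pigeonhole N<m (λ i → to (f i))
  ... | i , j , i<j , eq = i , j , i<j , to-injective eq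

-- Fermat's little theorem for a finite field of order N with a primitive element g:
-- the powers of g have period exactly N - 1, hence x ↑ N ≡ x for every x.  For even N
-- this forces -1 = (-1) ↑ N = 1, i.e. characteristic two.
module Fermat (F : Field) {N : ℕ} (ord : Field.Carrier F ↔ Fin N) (g : Field.Carrier F) (prim : IsPrimitive F g) where
  open Field F renaming (_^_ to _↑_)
  open FieldArithmetic F
  open FiniteField F ord

  g≢0 : g ≢ 0#
  g≢0 = proj₁ prim

  -- 0, g⁰, g¹, …: the values of Fin (suc N) used in the pigeonhole argument
  powerOrZero : ℕ → Carrier
  powerOrZero zero = 0#
  powerOrZero (suc n) = g ↑ n

  collision⇒period : ∀ a b → a < b → b < suc N → powerOrZero a ≡ powerOrZero b →
                     ∃[ r ] (0 < r × r < N × g ↑ r ≡ 1#)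
  collision⇒period zero (suc b) _ _ 0≡gᵇ = ⊥-elim (↑-nonzero g≢0 b (sym 0≡gᵇ))
  collision⇒period (suc a) (suc b) (s≤s a<b) (s≤s b<N) gᵃ≡gᵇ =
    b ℕ.∸ a , ℕ.m<n⇒0<n∸m a<b , ℕ.≤-<-trans (ℕ.m∸n≤m b a) b<N , *-cancelˡ (↑-nonzero g≢0 a) (begin
      g ↑ a * g ↑ (b ℕ.∸ a) ≡⟨ sym (↑-+ g a (b ℕ.∸ a)) ⟩
      g ↑ (a ℕ.+ (b ℕ.∸ a)) ≡⟨ cong (g ↑_) (ℕ.m+[n∸m]≡n (ℕ.<⇒≤ a<b)) ⟩
      g ↑ b                 ≡⟨ sym gᵃ≡gᵇ ⟩
      g ↑ a                 ≡⟨ sym (*-identityʳ _) ⟩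
      g ↑ a * 1#            ∎)
    where open ≡-Reasoning

  period : ∃[ r ] (0 < r × r < N × g ↑ r ≡ 1#)
  period with pigeonhole (ℕ.n<1+n N) (λ i → powerOrZero (toℕ i))
  ... | i , j , i<j , eq = collision⇒period (toℕ i) (toℕ j) i<j (Fin.toℕ<n j) eq

  -- with a period r, every nonzero element is g ↑ n for some n < r; this injects the
  -- field into Fin (suc r), so N ≤ r + 1
  module _ (r : ℕ) (0<r : 0 < r) (gʳ≡1 : g ↑ r ≡ 1#) where
    instance
      r≢0 : ℕ.NonZero r
      r≢0 = ℕ.>-nonZero 0<r

    ↑-mod : ∀ n → g ↑ n ≡ g ↑ (n % r)
    ↑-mod n = begin
      g ↑ n                                ≡⟨ cong (g ↑_) (m≡m%n+[m/n]*n n r) ⟩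
      g ↑ (n % r ℕ.+ (n / r) ℕ.* r)        ≡⟨ ↑-+ g (n % r) _ ⟩
      g ↑ (n % r) * g ↑ ((n / r) ℕ.* r)    ≡⟨ cong (λ e → g ↑ (n % r) * g ↑ e) (ℕ.*-comm (n / r) r) ⟩
      g ↑ (n % r) * g ↑ (r ℕ.* (n / r))    ≡⟨ cong (g ↑ (n % r) *_) (sym (↑-* g r (n / r))) ⟩
      g ↑ (n % r) * (g ↑ r) ↑ (n / r)      ≡⟨ cong (λ e → g ↑ (n % r) * e ↑ (n / r)) gʳ≡1 ⟩
      g ↑ (n % r) * 1# ↑ (n / r)           ≡⟨ cong (g ↑ (n % r) *_) (1↑n (n / r)) ⟩
      g ↑ (n % r) * 1#                     ≡⟨ *-identityʳ _ ⟩
      g ↑ (n % r)                          ∎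
      where open ≡-Reasoning

    -- discrete logarithm modulo r, with 0 sent to a separate value
    log : Carrier → Fin (suc r)
    log x with x ≟ 0#
    ... | yes _ = Fin.zero
    ... | no x≢0 = Fin.suc (fromℕ< (m%n<n (proj₁ (proj₂ prim x x≢0)) r))

    exp : Fin (suc r) → Carrier
    exp Fin.zero = 0#
    exp (Fin.suc i) = g ↑ toℕ i

    exp-log : ∀ x → exp (log x) ≡ x
    exp-log x with x ≟ 0#
    ... | yes x≡0 = sym x≡0
    ... | no x≢0 with proj₂ prim x x≢0
    ...   | n , x≡gⁿ = trans (cong (g ↑_) (Fin.toℕ-fromℕ< (m%n<n n r))) (sym (trans x≡gⁿ (↑-mod n)))

    N≤1+period : N ≤ suc r
    N≤1+period = injection⇒≤ log (λ {x} {y} eq → trans (sym (exp-log x)) (trans (cong exp eq) (exp-log y)))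

  order : ∃[ r ] (suc r ≡ N × g ↑ r ≡ 1#)
  order with period
  ... | r , 0<r , r<N , gʳ≡1 = r , ℕ.≤-antisym r<N (N≤1+period r 0<r gʳ≡1) , gʳ≡1

  -- Fermat's little theorem: x ↑ N = x, since x = 0 or x = g ↑ n and g ↑ N = g
  fermat : ∀ x → x ↑ N ≡ x
  fermat x with order | x ≟ 0#
  ... | r , refl , _ | yes refl = zeroˡ _
  ... | r , refl , gʳ≡1 | no x≢0 with proj₂ prim x x≢0
  ...   | n , refl = begin
      (g ↑ n) ↑ suc r    ≡⟨ ↑-* g n (suc r) ⟩
      g ↑ (n ℕ.* suc r)  ≡⟨ cong (g ↑_) (ℕ.*-comm n (suc r)) ⟩
      g ↑ (suc r ℕ.* n)  ≡⟨ sym (↑-* g (suc r) n) ⟩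
      (g * g ↑ r) ↑ n    ≡⟨ cong (λ e → (g * e) ↑ n) gʳ≡1 ⟩
      (g * 1#) ↑ n       ≡⟨ cong (_↑ n) (*-identityʳ g) ⟩
      g ↑ n              ∎
    where open ≡-Reasoning

  -- in a field of even order, -1 = (-1) ↑ N = ((-1) ↑ 2) ↑ (N / 2) = 1
  characteristic-two : ∀ {M} → N ≡ 2 ℕ.* M → 1# + 1# ≡ 0#
  characteristic-two {M} N≡2M = begin
      1# + 1#                ≡⟨ cong (1# +_) (sym -1≡1) ⟩
      1# + - 1#              ≡⟨ -‿inverseʳ 1# ⟩
      0#                     ∎
    where
    open ≡-Reasoning
    open RingProperties ring using (-1*x≈-x; -‿involutive)
    -1≡1 : - 1# ≡ 1#
    -1≡1 = begin
      - 1#                   ≡⟨ sym (fermat (- 1#)) ⟩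
      (- 1#) ↑ N             ≡⟨ cong ((- 1#) ↑_) N≡2M ⟩
      (- 1#) ↑ (2 ℕ.* M)     ≡⟨ sym (↑-* (- 1#) 2 M) ⟩
      (- 1# * (- 1# * 1#)) ↑ M ≡⟨ cong (λ e → (- 1# * e) ↑ M) (*-identityʳ (- 1#)) ⟩
      (- 1# * - 1#) ↑ M      ≡⟨ cong (_↑ M) (trans (-1*x≈-x (- 1#)) (-‿involutive 1#)) ⟩
      1# ↑ M                 ≡⟨ 1↑n M ⟩
      1#                     ∎

module BitSequences where
  Agree : ℕ → (ℕ → Bool) → (ℕ → Bool) → Set
  Agree n c c′ = ∀ i → i < n → c i ≡ c′ i

  Agree-suc : ∀ {n c c′} → Agree (suc n) c c′ → Agree n c c′
  Agree-suc agree i i<n = agree i (ℕ.m<n⇒m<1+n i<n)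

  _∷ᶜ_ : Bool → (ℕ → Bool) → ℕ → Bool
  (b ∷ᶜ c) zero = b
  (b ∷ᶜ c) (suc i) = c i

  xor-false : ∀ {b c} → (b xor c) ≡ false → b ≡ c
  xor-false {false} {false} _ = refl
  xor-false {true} {true} _ = refl

  bit : Bool → Fin 2
  bit false = Fin.zero
  bit true = Fin.suc Fin.zero

  bool : Fin 2 → Bool
  bool Fin.zero = false
  bool (Fin.suc _) = true

  bit-bool : ∀ i → bit (bool i) ≡ i
  bit-bool Fin.zero = refl
  bit-bool (Fin.suc Fin.zero) = refl

  bit-injective : ∀ {b b′} → bit b ≡ bit b′ → b ≡ b′
  bit-injective {false} {false} _ = refl
  bit-injective {true} {true} _ = refl

  encode : ∀ n → (ℕ → Bool) → Fin (2 ^ n)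
  encode zero c = Fin.zero
  encode (suc n) c = Fin.combine (bit (c 0)) (encode n (λ i → c (suc i)))

  encode-injective : ∀ n {c c′} → encode n c ≡ encode n c′ → Agree n c c′
  encode-injective (suc n) {c} {c′} eq zero _ =
    bit-injective (Fin.combine-injectiveˡ (bit (c 0)) _ (bit (c′ 0)) _ eq)
  encode-injective (suc n) {c} {c′} eq (suc i) (s≤s i<n) =
    encode-injective n (Fin.combine-injectiveʳ (bit (c 0)) (encode n (λ i → c (suc i))) (bit (c′ 0)) _ eq) i i<n

  encode-cong : ∀ n {c c′} → Agree n c c′ → encode n c ≡ encode n c′
  encode-cong zero agree = refl
  encode-cong (suc n) agree =
    cong₂ Fin.combine (cong bit (agree 0 (s≤s z≤n))) (encode-cong n (λ i i<n → agree (suc i) (s≤s i<n)))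

  decode : ∀ n → Fin (2 ^ n) → ℕ → Bool
  decode zero x i = false
  decode (suc n) x = bool (Fin.quotient (2 ^ n) x) ∷ᶜ decode n (Fin.remainder {2} (2 ^ n) x)

  encode-decode : ∀ n x → encode n (decode n x) ≡ x
  encode-decode zero Fin.zero = refl
  encode-decode (suc n) x = begin
    Fin.combine (bit (bool q)) (encode n (decode n r)) ≡⟨ cong₂ Fin.combine (bit-bool q) (encode-decode n r) ⟩
    Fin.combine q r                                    ≡⟨ Fin.combine-remQuot {2} (2 ^ n) x ⟩
    x                                                  ∎
    where
    open ≡-Reasoning
    q = Fin.quotient (2 ^ n) x
    r = Fin.remainder {2} (2 ^ n) x

  decode-injective : ∀ n {x y} → Agree n (decode n x) (decode n y) → x ≡ y
  decode-injective n {x} {y} agree =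
    trans (sym (encode-decode n x)) (trans (encode-cong n agree) (encode-decode n y))

open BitSequences

module Combinations (F : Field) (char2 : Field._+_ F (Field.1# F) (Field.1# F) ≡ Field.0# F)
                    (g : Field.Carrier F) where
  open Field F renaming (_^_ to _↑_)
  open FieldArithmetic F

  x+x≡0 : ∀ x → x + x ≡ 0#
  x+x≡0 x = begin
    x + x              ≡⟨ cong₂ _+_ (sym (*-identityʳ x)) (sym (*-identityʳ x)) ⟩
    x * 1# + x * 1#    ≡⟨ sym (distribˡ x 1# 1#) ⟩
    x * (1# + 1#)      ≡⟨ cong (x *_) char2 ⟩
    x * 0#             ≡⟨ zeroʳ x ⟩
    0#                 ∎
    where open ≡-Reasoning

  +≡0⇒≡ : ∀ {x y} → x + y ≡ 0# → x ≡ y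
  +≡0⇒≡ {x} {y} x+y≡0 = begin
    x                  ≡⟨ sym (+-identityʳ x) ⟩
    x + 0#             ≡⟨ cong (x +_) (sym (x+x≡0 y)) ⟩
    x + (y + y)        ≡⟨ sym (+-assoc x y y) ⟩
    (x + y) + y        ≡⟨ cong (_+ y) x+y≡0 ⟩
    0# + y             ≡⟨ +-identityˡ y ⟩
    y                  ∎
    where open ≡-Reasoning

  ι-xor : ∀ b c → ι (b xor c) ≡ ι b + ι c
  ι-xor false c = sym (+-identityˡ (ι c))
  ι-xor true false = sym (+-identityʳ 1#)
  ι-xor true true = sym char2

  ι-∧ : ∀ b c → ι (b ∧ c) ≡ ι b * ι c
  ι-∧ false c = sym (zeroˡ (ι c))
  ι-∧ true c = sym (*-identityˡ (ι c))

  eval : ℕ → (ℕ → Bool) → Carrier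
  eval zero c = 0#
  eval (suc n) c = eval n c + ι (c n) * g ↑ n

  eval-cong : ∀ n {c c′} → Agree n c c′ → eval n c ≡ eval n c′
  eval-cong zero agree = refl
  eval-cong (suc n) agree =
    cong₂ (λ e b → e + ι b * g ↑ n) (eval-cong n (Agree-suc agree)) (agree n (ℕ.n<1+n n))

  eval-zeros : ∀ n {c} → Agree n c (λ _ → false) → eval n c ≡ 0#
  eval-zeros n agree = trans (eval-cong n agree) (zeros n)
    where
    zeros : ∀ n → eval n (λ _ → false) ≡ 0#
    zeros zero = refl
    zeros (suc n) = trans (cong₂ _+_ (zeros n) (zeroˡ _)) (+-identityʳ 0#)

  eval-xor : ∀ n c c′ → eval n (λ i → c i xor c′ i) ≡ eval n c + eval n c′
  eval-xor zero c c′ = sym (+-identityʳ 0#)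
  eval-xor (suc n) c c′ = begin
    eval n (λ i → c i xor c′ i) + ι (c n xor c′ n) * g ↑ n
      ≡⟨ cong₂ (λ e b → e + b * g ↑ n) (eval-xor n c c′) (ι-xor (c n) (c′ n)) ⟩
    (eval n c + eval n c′) + (ι (c n) + ι (c′ n)) * g ↑ n
      ≡⟨ solve 5 (λ e e′ b b′ p → (e :+ e′) :+ (b :+ b′) :* p := (e :+ b :* p) :+ (e′ :+ b′ :* p))
               refl (eval n c) (eval n c′) (ι (c n)) (ι (c′ n)) (g ↑ n) ⟩
    (eval n c + ι (c n) * g ↑ n) + (eval n c′ + ι (c′ n) * g ↑ n) ∎
    where open ≡-Reasoning

  eval-∧ : ∀ n b c → eval n (λ i → b ∧ c i) ≡ ι b * eval n c
  eval-∧ zero b c = sym (zeroʳ (ι b))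
  eval-∧ (suc n) b c = begin
    eval n (λ i → b ∧ c i) + ι (b ∧ c n) * g ↑ n
      ≡⟨ cong₂ (λ e β → e + β * g ↑ n) (eval-∧ n b c) (ι-∧ b (c n)) ⟩
    ι b * eval n c + (ι b * ι (c n)) * g ↑ n
      ≡⟨ solve 4 (λ β e γ p → β :* e :+ (β :* γ) :* p := β :* (e :+ γ :* p)) refl (ι b) (eval n c) (ι (c n)) (g ↑ n) ⟩
    ι b * (eval n c + ι (c n) * g ↑ n) ∎
    where open ≡-Reasoning

  eval-shift : ∀ n c → g * eval n c ≡ eval (suc n) (false ∷ᶜ c)
  eval-shift zero c = begin
    g * 0#               ≡⟨ zeroʳ g ⟩
    0#                   ≡⟨ sym (trans (+-identityˡ _) (zeroˡ _)) ⟩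
    0# + 0# * 1#         ∎
    where open ≡-Reasoning
  eval-shift (suc n) c = begin
    g * (eval n c + ι (c n) * g ↑ n)               ≡⟨ solve 4 (λ γ e b p → γ :* (e :+ b :* p) := γ :* e :+ b :* (γ :* p)) refl g (eval n c) (ι (c n)) (g ↑ n) ⟩
    g * eval n c + ι (c n) * g ↑ suc n             ≡⟨ cong (_+ ι (c n) * g ↑ suc n) (eval-shift n c) ⟩
    eval (suc n) (false ∷ᶜ c) + ι (c n) * g ↑ suc n ∎
    where open ≡-Reasoning

  δ : ℕ → ℕ → Bool
  δ j i = does (i ℕ.≟ j)

  eval-δ : ∀ n j → j < n → eval n (δ j) ≡ g ↑ j
  eval-δ (suc n) j j<1+n with ℕ.m≤n⇒m<n∨m≡n (ℕ.≤-pred j<1+n)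
  ... | inj₁ j<n = begin
    eval n (δ j) + ι (δ j n) * g ↑ n  ≡⟨ cong₂ (λ e b → e + ι b * g ↑ n) (eval-δ n j j<n) (dec-false (n ℕ.≟ j) (ℕ.>⇒≢ j<n)) ⟩
    g ↑ j + 0# * g ↑ n                ≡⟨ trans (cong (g ↑ j +_) (zeroˡ _)) (+-identityʳ _) ⟩
    g ↑ j                             ∎
    where open ≡-Reasoning
  ... | inj₂ refl = begin
    eval j (δ j) + ι (δ j j) * g ↑ j  ≡⟨ cong₂ (λ e b → e + ι b * g ↑ j) (eval-zeros j (λ i i<j → dec-false (i ℕ.≟ j) (ℕ.<⇒≢ i<j))) (dec-true (j ℕ.≟ j) refl) ⟩
    0# + 1# * g ↑ j                   ≡⟨ trans (+-identityˡ _) (*-identityˡ _) ⟩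
    g ↑ j                             ∎
    where open ≡-Reasoning

  MonicRelation : ℕ → Set
  MonicRelation d = ∃[ a ] (g ↑ d ≡ eval d a)

  -- a nontrivial vanishing combination yields a relation: its leading term is
  -- (in characteristic two) equal to the sum of the lower ones
  kernel⇒relation : ∀ n c → eval n c ≡ 0# → ¬ Agree n c (λ _ → false) → ∃[ d ] (d < n × MonicRelation d)
  kernel⇒relation zero c _ nontrivial = ⊥-elim (nontrivial (λ _ ()))
  kernel⇒relation (suc n) c evalc≡0 nontrivial with c n in cₙ
  ... | true = n , ℕ.n<1+n n , c , sym (+≡0⇒≡ (trans (cong (eval n c +_) (sym (*-identityˡ _))) evalc≡0))
  ... | false = let (d , d<n , rel) = kernel⇒relation n c lower≡0 lower-nontrivial in d , ℕ.m<n⇒m<1+n d<n , rel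
    where
    lower≡0 : eval n c ≡ 0#
    lower≡0 = trans (sym (trans (cong (eval n c +_) (zeroˡ _)) (+-identityʳ _))) evalc≡0
    lower-nontrivial : ¬ Agree n c (λ _ → false)
    lower-nontrivial agree = nontrivial λ i i<1+n → case ℕ.m≤n⇒m<n∨m≡n (ℕ.≤-pred i<1+n) of λ where
      (inj₁ i<n) → agree i i<n
      (inj₂ refl) → cₙ

  -- multiplication by g, on combinations of degree ≤ d, when g ↑ suc d = eval (suc d) a
  times-g : ℕ → (ℕ → Bool) → (ℕ → Bool) → ℕ → Bool
  times-g d a c i = (false ∷ᶜ c) i xor (c d ∧ a i)

  eval-times-g : ∀ d a c → g ↑ suc d ≡ eval (suc d) a → g * eval (suc d) c ≡ eval (suc d) (times-g d a c)
  eval-times-g d a c gᵈ⁺¹≡a = begin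
    g * eval (suc d) c                                          ≡⟨ eval-shift (suc d) c ⟩
    eval (suc d) (false ∷ᶜ c) + ι (c d) * g ↑ suc d             ≡⟨ cong (λ e → eval (suc d) (false ∷ᶜ c) + ι (c d) * e) gᵈ⁺¹≡a ⟩
    eval (suc d) (false ∷ᶜ c) + ι (c d) * eval (suc d) a        ≡⟨ cong (eval (suc d) (false ∷ᶜ c) +_) (sym (eval-∧ (suc d) (c d) a)) ⟩
    eval (suc d) (false ∷ᶜ c) + eval (suc d) (λ i → c d ∧ a i)  ≡⟨ sym (eval-xor (suc d) (false ∷ᶜ c) (λ i → c d ∧ a i)) ⟩
    eval (suc d) (times-g d a c)                                ∎
    where open ≡-Reasoning

-- Then 1, g, …, g^(h-1) is an F₂-basis of F: from a relation of degree d every power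
-- of g, hence every element, is a combination of degree < d, which by counting forces
-- d ≥ h; a relation of degree ≤ h exists by pigeonhole on the 2^(h+1) combinations
-- of degree ≤ h.
module PowerBasis (F : Field) (char2 : Field._+_ F (Field.1# F) (Field.1# F) ≡ Field.0# F)
                  (g : Field.Carrier F) (prim : IsPrimitive F g)
                  (n : ℕ) (ord : Field.Carrier F ↔ Fin (2 ^ suc n)) where
  open Field F renaming (_^_ to _↑_)
  open FieldArithmetic F
  open FiniteField F ord
  open Combinations F char2 g public

  h : ℕ
  h = suc n

  Spanning : ℕ → Set
  Spanning d = ∀ x → ∃[ c ] (x ≡ eval d c)

  relation⇒spanning : ∀ d → MonicRelation d → Spanning d
  relation⇒spanning zero (_ , 1≡0) x = ⊥-elim (0≢1 (sym 1≡0))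
  relation⇒spanning (suc d) (a , gᵈ⁺¹≡a) x with x ≟ 0#
  ... | yes refl = (λ _ → false) , sym (eval-zeros (suc d) (λ _ _ → refl))
  ... | no x≢0 with proj₂ prim x x≢0
  ...   | k , refl = powers k
    where
    powers : ∀ k → ∃[ c ] (g ↑ k ≡ eval (suc d) c)
    powers zero = δ 0 , sym (eval-δ (suc d) 0 (s≤s z≤n))
    powers (suc k) with powers k
    ... | c , gᵏ≡c = times-g d a c , trans (cong (g *_) gᵏ≡c) (eval-times-g d a c gᵈ⁺¹≡a)

  -- counting: combinations of degree < d give at most 2 ^ d elements
  spanning⇒h≤ : ∀ d → Spanning d → h ≤ d
  spanning⇒h≤ d spanning = ℕ.≮⇒≥ λ d<h →
    ℕ.<⇒≱ (ℕ.^-monoʳ-< 2 (s≤s (s≤s z≤n)) d<h) (injection⇒≤ (λ x → encode d (coefficients x)) injective)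
    where
    coefficients : Carrier → ℕ → Bool
    coefficients x = proj₁ (spanning x)
    injective : ∀ {x y} → encode d (coefficients x) ≡ encode d (coefficients y) → x ≡ y
    injective {x} {y} eq = trans (proj₂ (spanning x))
      (trans (eval-cong d (encode-injective d eq)) (sym (proj₂ (spanning y))))

  -- two of the 2 ^ (h + 1) combinations of degree ≤ h coincide; their difference is a
  -- nontrivial vanishing combination, giving a relation of degree ≤ h
  relation-of-degree≤h : ∃[ d ] (d < suc h × MonicRelation d)
  relation-of-degree≤h with pigeonhole (ℕ.^-monoʳ-< 2 (s≤s (s≤s z≤n)) (ℕ.n<1+n h)) (λ x → eval (suc h) (decode (suc h) x))
  ... | x , y , x<y , eq = kernel⇒relation (suc h) difference difference-vanishes difference-nontrivial
    where
    difference : ℕ → Bool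
    difference i = decode (suc h) x i xor decode (suc h) y i
    difference-vanishes : eval (suc h) difference ≡ 0#
    difference-vanishes = begin
      eval (suc h) difference                                      ≡⟨ eval-xor (suc h) (decode (suc h) x) (decode (suc h) y) ⟩
      eval (suc h) (decode (suc h) x) + eval (suc h) (decode (suc h) y) ≡⟨ cong (_+ eval (suc h) (decode (suc h) y)) eq ⟩
      eval (suc h) (decode (suc h) y) + eval (suc h) (decode (suc h) y) ≡⟨ x+x≡0 _ ⟩
      0#                                                           ∎
      where open ≡-Reasoning
    difference-nontrivial : ¬ Agree (suc h) difference (λ _ → false)
    difference-nontrivial agree = Fin.<⇒≢ x<y (decode-injective (suc h) {x} {y} λ i i<1+h → xor-false (agree i i<1+h))

  minimalRelation : MonicRelation h
  minimalRelation = degree-h relation-of-degree≤h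
    where
    degree-h : ∃[ d ] (d < suc h × MonicRelation d) → MonicRelation h
    degree-h (d , d<1+h , rel) =
      subst MonicRelation (ℕ.≤-antisym (ℕ.≤-pred d<1+h) (spanning⇒h≤ d (relation⇒spanning d rel))) rel

  m : ℕ → Bool
  m = proj₁ minimalRelation

  g↑h≡m : g ↑ h ≡ eval h m
  g↑h≡m = proj₂ minimalRelation

  no-relation-below-h : ∀ {d} → d < h → ¬ MonicRelation d
  no-relation-below-h {d} d<h rel = ℕ.<⇒≱ d<h (spanning⇒h≤ d (relation⇒spanning d rel))

  eval-kernel : ∀ {c} → eval h c ≡ 0# → Agree h c (λ _ → false)
  eval-kernel {c} evalc≡0 i i<h = ¬-not {y = true} λ cᵢ≡true →
    let (d , d<h , rel) = kernel⇒relation h c evalc≡0 (λ agree → not-¬ cᵢ≡true (agree i i<h))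
    in no-relation-below-h d<h rel

  eval-injective : ∀ {c c′} → eval h c ≡ eval h c′ → Agree h c c′
  eval-injective {c} {c′} eq i i<h = xor-false (eval-kernel difference-vanishes i i<h)
    where
    difference-vanishes : eval h (λ i → c i xor c′ i) ≡ 0#
    difference-vanishes = trans (eval-xor h c c′) (trans (cong (_+ eval h c′) eq) (x+x≡0 (eval h c′)))

  co : Carrier → ℕ → Bool
  co x = proj₁ (relation⇒spanning h minimalRelation x)

  co-eval : ∀ x → eval h (co x) ≡ x
  co-eval x = sym (proj₂ (relation⇒spanning h minimalRelation x))

  co-unique : ∀ {x c} → eval h c ≡ x → Agree h (co x) c
  co-unique {x} evalc≡x = eval-injective (trans (co-eval x) (sym evalc≡x))

  co-+ : ∀ x y → Agree h (co (x + y)) (λ i → co x i xor co y i)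
  co-+ x y = co-unique (trans (eval-xor h (co x) (co y)) (cong₂ _+_ (co-eval x) (co-eval y)))

  co-scale : ∀ b x → Agree h (co (ι b * x)) (λ i → b ∧ co x i)
  co-scale b x = co-unique (trans (eval-∧ h b (co x)) (cong (ι b *_) (co-eval x)))

  co-↑ : ∀ j → j < h → Agree h (co (g ↑ j)) (δ j)
  co-↑ j j<h = co-unique (eval-δ h j j<h)

  co-↑h : Agree h (co (g ↑ h)) m
  co-↑h = co-unique (sym g↑h≡m)

  -- the minimal relation has constant term 1; otherwise dividing it by g would give a
  -- relation of degree h - 1
  m-constant : m 0 ≡ true
  m-constant = ¬-not {y = false} λ m₀≡false → no-relation-below-h (ℕ.n<1+n n) (m′ , *-cancelˡ (proj₁ prim) (begin
      g * g ↑ n                      ≡⟨ g↑h≡m ⟩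
      eval h m                       ≡⟨ eval-cong h (shifted m₀≡false) ⟩
      eval h (false ∷ᶜ m′)           ≡⟨ sym (eval-shift n m′) ⟩
      g * eval n m′                  ∎))
    where
    open ≡-Reasoning
    m′ : ℕ → Bool
    m′ i = m (suc i)
    shifted : m 0 ≡ false → Agree h m (false ∷ᶜ m′)
    shifted m₀≡false zero _ = m₀≡false
    shifted m₀≡false (suc i) _ = refl

  co-g*-constant : ∀ x → co (g * x) 0 ≡ co x n
  co-g*-constant x = begin
    co (g * x) 0               ≡⟨ co-unique g*x≡ 0 (s≤s z≤n) ⟩
    times-g n m (co x) 0       ≡⟨ cong (co x n ∧_) m-constant ⟩
    co x n ∧ true              ≡⟨ ∧-identityʳ (co x n) ⟩
    co x n                     ∎
    where
    open ≡-Reasoning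
    g*x≡ : eval h (times-g n m (co x)) ≡ g * x
    g*x≡ = trans (sym (eval-times-g n m (co x) g↑h≡m)) (cong (g *_) (co-eval x))

module ProjectiveLine (F : Field) where
  open Field F
  open FieldArithmetic F
  open Geometry F

  samePoint-sym : ∀ {P Q} → SamePoint P Q → SamePoint Q P
  samePoint-sym {Q = a , b} (μ , μ≢0 , refl) =
    inv μ μ≢0 , inv-nonzero μ μ≢0 , cong₂ _,_ (sym (inv-*-cancel μ μ≢0 a)) (sym (inv-*-cancel μ μ≢0 b))

  samePoint-trans : ∀ {P Q R} → SamePoint P Q → SamePoint Q R → SamePoint P R
  samePoint-trans {R = a , b} (μ , μ≢0 , refl) (ν , ν≢0 , refl) =
    μ * ν , *-nonzero μ≢0 ν≢0 , cong₂ _,_ (sym (*-assoc μ ν a)) (sym (*-assoc μ ν b))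

  affine : ∀ a b (b≢0 : b ≢ 0#) → SamePoint (a , b) (a * inv b b≢0 , 1#)
  affine a b b≢0 = b , b≢0 , cong₂ _,_ (sym a≡) (sym (*-identityʳ b))
    where
    a≡ : b * (a * inv b b≢0) ≡ a
    a≡ = trans (solve 3 (λ a b c → b :* (a :* c) := a :* (b :* c)) refl a b (inv b b≢0))
               (trans (cong (a *_) (*-inverseʳ b b≢0)) (*-identityʳ a))

  rescale : ∀ β (β≢0 : β ≢ 0#) x → (x , 1#) ≡ inv β β≢0 · (β * x , β)
  rescale β β≢0 x = cong₂ _,_ (sym (inv-*-cancel β β≢0 x))
    (sym (trans (*-comm _ β) (*-inverseʳ β β≢0)))

  onHead : ∀ a → a ≢ 0# → SamePoint (a , 0#) (1# , 0#)
  onHead a a≢0 = a , a≢0 , cong₂ _,_ (sym (*-identityʳ a)) (sym (zeroʳ a))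

module ClubComplement (k : ℕ) (F : Field) (ord : Field.Carrier F ↔ Fin (2 ^ suc (suc (suc k))))
                      (g : Field.Carrier F) (prim : IsPrimitive F g) where
  open Field F renaming (_^_ to _↑_)
  open FieldArithmetic F
  open FiniteField F ord
  open Geometry F
  open ProjectiveLine F

  -- the index h - 1 (h = k + 3 is the degree of F over F₂)
  top : ℕ
  top = suc (suc k)

  open PowerBasis F (Fermat.characteristic-two F ord g prim {2 ^ top} refl) g prim top ord
  open Club F h g

  top<h : top < h
  top<h = ℕ.n<1+n top

  0<h : 0 < h
  0<h = s≤s z≤n

  φ₀ φ₁ φ₂ : Carrier → Bool
  φ₀ x = co x 0
  φ₁ x = co x top
  φ₂ x = co (g * x) top

  co-zero : Agree h (co 0#) (λ _ → false)
  co-zero = co-unique (eval-zeros h (λ _ _ → refl))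

  co-+-scaled : ∀ x b y → Agree h (co (x + ι b * y)) (λ i → co x i xor (b ∧ co y i))
  co-+-scaled x b y i i<h = trans (co-+ x (ι b * y) i i<h) (cong (co x i xor_) (co-scale b y i i<h))

  -- the possible second coordinates ι p + ι r g of a club vector
  slope : Bool → Bool → Carrier
  slope p r = ι p + ι r * g

  co-slope : ∀ p r x → Agree h (co (slope p r * x)) (λ i → (p ∧ co x i) xor (r ∧ co (g * x) i))
  co-slope p r x = co-unique (begin
    eval h (λ i → (p ∧ co x i) xor (r ∧ co (g * x) i))
      ≡⟨ eval-xor h _ _ ⟩
    eval h (λ i → p ∧ co x i) + eval h (λ i → r ∧ co (g * x) i)
      ≡⟨ cong₂ _+_ (eval-∧ h p (co x)) (eval-∧ h r (co (g * x))) ⟩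
    ι p * eval h (co x) + ι r * eval h (co (g * x))
      ≡⟨ cong₂ (λ a b → ι p * a + ι r * b) (co-eval x) (co-eval (g * x)) ⟩
    ι p * x + ι r * (g * x)
      ≡⟨ solve 4 (λ p r g x → p :* x :+ r :* (g :* x) := (p :+ r :* g) :* x) refl (ι p) (ι r) g x ⟩
    slope p r * x ∎)
    where open ≡-Reasoning

  slope-constant : ∀ p r x → co (slope p r * x) 0 ≡ (p ∧ φ₀ x) xor (r ∧ φ₁ x)
  slope-constant p r x = trans (co-slope p r x 0 0<h) (cong (λ b → (p ∧ φ₀ x) xor (r ∧ b)) (co-g*-constant x))

  slope-top : ∀ p r x → co (slope p r * x) top ≡ (p ∧ φ₁ x) xor (r ∧ φ₂ x)
  slope-top p r x = co-slope p r x top top<h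

  -- the slope is zero only for p = r = false; for nonzero slopes compare the
  -- coordinates 0 and 1 of slope p r = ι p g⁰ + ι r g¹
  slope-nonzero : ∀ p r → (p ∨ r) ≡ true → slope p r ≢ 0#
  slope-nonzero p r p∨r slope≡0 = coefficients-vanish p r p∨r
      (trans (sym (coefficient 0 0<h)) (vanishes 0 0<h))
      (trans (sym (coefficient 1 (s≤s (s≤s z≤n)))) (vanishes 1 (s≤s (s≤s z≤n))))
    where
    coefficient : ∀ i → i < h → co (slope p r * 1#) i ≡ (p ∧ δ 0 i) xor (r ∧ δ 1 i)
    coefficient i i<h = trans (co-slope p r 1# i i<h)
      (cong₂ (λ a b → (p ∧ a) xor (r ∧ b)) (co-↑ 0 0<h i i<h) (co-↑ 1 (s≤s (s≤s z≤n)) i i<h))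
    vanishes : Agree h (co (slope p r * 1#)) (λ _ → false)
    vanishes i i<h = trans (cong (λ y → co y i) (trans (cong (_* 1#) slope≡0) (zeroˡ 1#))) (co-zero i i<h)
    coefficients-vanish : ∀ p r → (p ∨ r) ≡ true → ((p ∧ true) xor (r ∧ false)) ≡ false →
                          ((p ∧ false) xor (r ∧ true)) ≡ false → ⊥
    coefficients-vanish true false _ ()
    coefficients-vanish true true _ _ ()
    coefficients-vanish false true _ _ ()
    coefficients-vanish false false ()

  nonzero-slope : ∀ p r → slope p r ≢ 0# → (p ∨ r) ≡ true
  nonzero-slope false false slope≢0 = ⊥-elim (slope≢0 (trans (+-identityˡ _) (zeroˡ g)))
  nonzero-slope false true _ = refl
  nonzero-slope true r _ = refl

  -- a club vector is (eval h T , slope T_{h-1} T_h) for T = coord t, whose constant term is 0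
  sumFrom1≡eval : ∀ n c → c 0 ≡ false → sumFrom1 n (λ i → ι (c i) * g ↑ i) ≡ eval (suc n) c
  sumFrom1≡eval zero c c₀≡false =
    sym (trans (+-identityˡ _) (trans (cong (λ b → ι b * 1#) c₀≡false) (zeroˡ 1#)))
  sumFrom1≡eval (suc n) c c₀≡false = cong (_+ ι (c (suc n)) * g ↑ suc n) (sumFrom1≡eval n c c₀≡false)

  clubVec≡ : ∀ t → clubVec t ≡ (eval h (coord t) , slope (coord t top) (coord t h))
  clubVec≡ t = cong (_, slope (coord t top) (coord t h)) (sumFrom1≡eval top (coord t) refl)

  -- conversely, the tuple with coord t = T on 1, …, h-1 and t_h = r
  tupleEntry : (ℕ → Bool) → Bool → ℕ → Bool
  tupleEntry T r j = if does (j ℕ.≟ top) then r else T (suc j)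

  clubTuple : (ℕ → Bool) → Bool → Fin h → Bool
  clubTuple T r i = tupleEntry T r (toℕ i)

  coord-clubTuple : ∀ T r j → j < h → coord (clubTuple T r) (suc j) ≡ tupleEntry T r j
  coord-clubTuple T r j j<h with j ℕ.<? h
  ... | yes j<h′ = cong (tupleEntry T r) (Fin.toℕ-fromℕ< j<h′)
  ... | no j≮h = ⊥-elim (j≮h j<h)

  tupleEntry-below : ∀ T r {j} → j < top → tupleEntry T r j ≡ T (suc j)
  tupleEntry-below T r {j} j<top = cong (λ b → if b then r else T (suc j)) (dec-false (j ℕ.≟ top) (ℕ.<⇒≢ j<top))

  tupleEntry-top : ∀ T r → tupleEntry T r top ≡ r
  tupleEntry-top T r = cong (λ b → if b then r else T h) (dec-true (top ℕ.≟ top) refl)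

  clubTuple-coord : ∀ T r → T 0 ≡ false → Agree h (coord (clubTuple T r)) T
  clubTuple-coord T r T₀≡false zero _ = sym T₀≡false
  clubTuple-coord T r T₀≡false (suc j) 1+j<h =
    trans (coord-clubTuple T r j (ℕ.<-trans (ℕ.n<1+n j) 1+j<h)) (tupleEntry-below T r (ℕ.≤-pred 1+j<h))

  clubTuple-last : ∀ T r → coord (clubTuple T r) h ≡ r
  clubTuple-last T r = trans (coord-clubTuple T r top top<h) (tupleEntry-top T r)

  clubTuple-nonzero : ∀ T r → (T top ∨ r) ≡ true → NonzeroTuple (clubTuple T r)
  clubTuple-nonzero T true _ = fromℕ< top<h , trans (cong (tupleEntry T true) (Fin.toℕ-fromℕ< top<h)) (tupleEntry-top T true)
  clubTuple-nonzero T false Tₜ∨false = fromℕ< k+1<h ,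
    trans (cong (tupleEntry T false) (Fin.toℕ-fromℕ< k+1<h))
          (trans (tupleEntry-below T false (ℕ.n<1+n (suc k))) (trans (sym (∨-identityʳ (T top))) Tₜ∨false))
    where
    k+1<h : suc k < h
    k+1<h = ℕ.<-trans (ℕ.n<1+n (suc k)) top<h

  -- slopes with this property are exactly the ways in which ⟨(x , 1)⟩ can lie on 𝒞
  SlopeCondition : (a b c p r : Bool) → Set
  SlopeCondition a b c p r = (p ∨ r) ≡ true × ((p ∧ a) xor (r ∧ b)) ≡ false × ((p ∧ b) xor (r ∧ c)) ≡ p

  -- if (x , 1) = ν (eval h T , β) is on the club then β = slope T_{h-1} T_h ≠ 0 and
  -- β x = eval h T, so co (β x) = T has constant term 0 and top coordinate T_{h-1}
  onClub⇒slope : ∀ x → InC (x , 1#) → ∃₂ (SlopeCondition (φ₀ x) (φ₁ x) (φ₂ x))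
  onClub⇒slope x (t , _ , ν , ν≢0 , x1≡) =
    p , r , p∨r , trans (sym (slope-constant p r x)) (co-βx 0 0<h) , trans (sym (slope-top p r x)) (co-βx top top<h)
    where
    open ≡-Reasoning
    T : ℕ → Bool
    T = coord t
    p r : Bool
    p = T top
    r = T h
    β : Carrier
    β = slope p r
    x1≡νclub : (x , 1#) ≡ ν · (eval h T , β)
    x1≡νclub = trans x1≡ (cong (ν ·_) (clubVec≡ t))
    1≡νβ : 1# ≡ ν * β
    1≡νβ = cong proj₂ x1≡νclub
    βx≡T : β * x ≡ eval h T
    βx≡T = begin
      β * x                  ≡⟨ cong (β *_) (cong proj₁ x1≡νclub) ⟩
      β * (ν * eval h T)     ≡⟨ solve 3 (λ b n e → b :* (n :* e) := (n :* b) :* e) refl β ν (eval h T) ⟩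
      (ν * β) * eval h T     ≡⟨ cong (_* eval h T) (sym 1≡νβ) ⟩
      1# * eval h T          ≡⟨ *-identityˡ _ ⟩
      eval h T               ∎
    co-βx : Agree h (co (β * x)) T
    co-βx = co-unique (sym βx≡T)
    p∨r : (p ∨ r) ≡ true
    p∨r = nonzero-slope p r (λ β≡0 → 0≢1 (sym (trans 1≡νβ (trans (cong (ν *_) β≡0) (zeroʳ ν)))))

  -- conversely, a slope β with this property gives the club vector (β x , β) of the
  -- tuple built from T = co (β x) and r, and (x , 1) = β⁻¹ (β x , β)
  slope⇒onClub : ∀ x p r → SlopeCondition (φ₀ x) (φ₁ x) (φ₂ x) p r → InC (x , 1#)
  slope⇒onClub x p r (p∨r , constant , topCoord) =
    clubTuple T r , clubTuple-nonzero T r (trans (cong (_∨ r) Tₜ≡p) p∨r) , inv β β≢0 , inv-nonzero β β≢0 ,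
    trans (rescale β β≢0 x) (cong (inv β β≢0 ·_) (sym clubVec≡βxβ))
    where
    β : Carrier
    β = slope p r
    β≢0 : β ≢ 0#
    β≢0 = slope-nonzero p r p∨r
    T : ℕ → Bool
    T = co (β * x)
    T₀≡false : T 0 ≡ false
    T₀≡false = trans (slope-constant p r x) constant
    Tₜ≡p : T top ≡ p
    Tₜ≡p = trans (slope-top p r x) topCoord
    t : Fin h → Bool
    t = clubTuple T r
    clubVec≡βxβ : clubVec t ≡ (β * x , β)
    clubVec≡βxβ = trans (clubVec≡ t) (cong₂ _,_
      (trans (eval-cong h (clubTuple-coord T r T₀≡false)) (co-eval (β * x)))
      (cong₂ slope (trans (clubTuple-coord T r T₀≡false top top<h) Tₜ≡p) (clubTuple-last T r)))

  classify : ∀ a b c → (a ≡ true × c ≡ true) ⊎ ∃₂ (SlopeCondition a b c)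
  classify true b true = inj₁ (refl , refl)
  classify false false false = inj₂ (false , true , refl , refl , refl)
  classify false false true = inj₂ (true , true , refl , refl , refl)
  classify false true c = inj₂ (true , false , refl , refl , refl)
  classify true false false = inj₂ (false , true , refl , refl , refl)
  classify true true false = inj₂ (true , true , refl , refl , refl)

  no-slope : ∀ b p r → ¬ SlopeCondition true b true p r
  no-slope b false false (() , _)
  no-slope false true false (_ , () , _)
  no-slope false true true (_ , () , _)
  no-slope false false true (_ , _ , ())
  no-slope true true false (_ , () , _)
  no-slope true false true (_ , () , _)
  no-slope true true true (_ , _ , ())

  offClub⇒ : ∀ x → ¬ InC (x , 1#) → φ₀ x ≡ true × φ₂ x ≡ true
  offClub⇒ x x∉C = [ id , (λ (p , r , condition) → ⊥-elim (x∉C (slope⇒onClub x p r condition))) ]′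
    (classify (φ₀ x) (φ₁ x) (φ₂ x))

  ⇒offClub : ∀ x → φ₀ x ≡ true → φ₂ x ≡ true → ¬ InC (x , 1#)
  ⇒offClub x φ₀x≡true φ₂x≡true x∈C =
    let (p , r , condition) = onClub⇒slope x x∈C
    in no-slope (φ₁ x) p r (subst₂ (λ a c → SlopeCondition a (φ₁ x) c p r) φ₀x≡true φ₂x≡true condition)

  InC-resp : ∀ {P Q} → SamePoint Q P → InC P → InC Q
  InC-resp Q~P (t , t≢0 , P~t) = t , t≢0 , samePoint-trans Q~P P~t

  InW : V → Set
  InW (a , b) = ∃[ s ] (b ≡ ι s × φ₀ a ≡ s × φ₂ a ≡ s)

  W : F2Subspace
  W = record { mem = InW ; mem-zero = zero∈W ; mem-+ = +∈W }
    where
    zero∈W : InW zeroV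
    zero∈W = false , refl , co-zero 0 0<h , trans (cong (λ y → co y top) (zeroʳ g)) (co-zero top top<h)
    +∈W : ∀ {P Q} → InW P → InW Q → InW (P ⊕ Q)
    +∈W {a , _} {a′ , _} (s , refl , φ₀a , φ₂a) (s′ , refl , φ₀a′ , φ₂a′) =
      s xor s′ , sym (ι-xor s s′) ,
      trans (co-+ a a′ 0 0<h) (cong₂ _xor_ φ₀a φ₀a′) ,
      trans (cong (λ y → co y top) (distribˡ g a a′)) (trans (co-+ (g * a) (g * a′) top top<h) (cong₂ _xor_ φ₂a φ₂a′))

  -- a nonzero (y₀ , 0) ∈ W: y₀ = g^(h-1) + m_{h-1} g^(h-2), so that
  -- g y₀ = g^h + m_{h-1} g^(h-1) has top coordinate m_{h-1} + m_{h-1} = 0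
  y₀ : Carrier
  y₀ = g ↑ top + ι (m top) * g ↑ suc k

  co-y₀ : Agree h (co y₀) (λ i → δ top i xor (m top ∧ δ (suc k) i))
  co-y₀ i i<h = trans (co-+-scaled (g ↑ top) (m top) (g ↑ suc k) i i<h)
    (cong₂ (λ a b → a xor (m top ∧ b)) (co-↑ top top<h i i<h) (co-↑ (suc k) (ℕ.<-trans (ℕ.n<1+n (suc k)) top<h) i i<h))

  δ-top-top : δ top top ≡ true
  δ-top-top = dec-true (top ℕ.≟ top) refl

  δ-below-top : δ (suc k) top ≡ false
  δ-below-top = dec-false (top ℕ.≟ suc k) (ℕ.>⇒≢ (ℕ.n<1+n (suc k)))

  φ₀y₀ : φ₀ y₀ ≡ false
  φ₀y₀ = trans (co-y₀ 0 0<h) (∧-zeroʳ (m top))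

  y₀≢0 : y₀ ≢ 0#
  y₀≢0 y₀≡0 = not-¬ refl (trans (sym co0≡true) (co-zero top top<h))
    where
    open ≡-Reasoning
    co0≡true : co 0# top ≡ true
    co0≡true = begin
      co 0# top                                     ≡⟨ cong (λ y → co y top) (sym y₀≡0) ⟩
      co y₀ top                                     ≡⟨ co-y₀ top top<h ⟩
      δ top top xor (m top ∧ δ (suc k) top)         ≡⟨ cong₂ (λ a b → a xor (m top ∧ b)) δ-top-top δ-below-top ⟩
      true xor (m top ∧ false)                      ≡⟨ cong (true xor_) (∧-zeroʳ (m top)) ⟩
      true                                          ∎

  φ₂y₀ : φ₂ y₀ ≡ false
  φ₂y₀ = begin
    co (g * y₀) top                              ≡⟨ cong (λ y → co y top) g*y₀≡ ⟩
    co (g ↑ h + ι (m top) * g ↑ top) top         ≡⟨ co-+-scaled (g ↑ h) (m top) (g ↑ top) top top<h ⟩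
    co (g ↑ h) top xor (m top ∧ co (g ↑ top) top) ≡⟨ cong₂ (λ a b → a xor (m top ∧ b)) (co-↑h top top<h) (trans (co-↑ top top<h top top<h) δ-top-top) ⟩
    m top xor (m top ∧ true)                     ≡⟨ cong (m top xor_) (∧-identityʳ (m top)) ⟩
    m top xor m top                              ≡⟨ xor-same (m top) ⟩
    false                                        ∎
    where
    open ≡-Reasoning
    g*y₀≡ : g * y₀ ≡ g ↑ h + ι (m top) * g ↑ top
    g*y₀≡ = solve 3 (λ g a b → g :* (g :* a :+ b :* a) := g :* (g :* a) :+ b :* (g :* a)) refl g (g ↑ suc k) (ι (m top))

  headInW : ∀ {P} → SamePoint P (1# , 0#) → InLinearSet W P
  headInW P~head = (y₀ , 0#) , (false , refl , φ₀y₀ , φ₂y₀) , (λ eq → y₀≢0 (cong proj₁ eq)) ,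
    samePoint-trans P~head (samePoint-sym (onHead y₀ y₀≢0))

  L_W⊆ : ∀ P → InLinearSet W P → Complement∪Head P
  L_W⊆ P ((a , _) , (false , refl , _) , w≢0 , P~w) =
    inj₂ (samePoint-trans P~w (onHead a (λ a≡0 → w≢0 (cong (_, 0#) a≡0))))
  L_W⊆ P ((a , _) , (true , refl , φ₀a , φ₂a) , _ , P~w) =
    inj₁ (λ P∈C → ⇒offClub a φ₀a φ₂a (InC-resp (samePoint-sym P~w) P∈C))

  offClub∈L_W : ∀ a b (b≢0 : b ≢ 0#) → ¬ InC (a , b) → InLinearSet W (a , b)
  offClub∈L_W a b b≢0 P∉C =
    (x , 1#) , (true , refl , offClub⇒ x x∉C) , (λ eq → 0≢1 (sym (cong proj₂ eq))) , affine a b b≢0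
    where
    x : Carrier
    x = a * inv b b≢0
    x∉C : ¬ InC (x , 1#)
    x∉C x∈C = P∉C (InC-resp (affine a b b≢0) x∈C)

  ⊆L_W : ∀ P → P ≢ zeroV → Complement∪Head P → InLinearSet W P
  ⊆L_W P _ (inj₂ P~head) = headInW P~head
  ⊆L_W (a , b) P≢0 (inj₁ P∉C) = case b ≟ 0# of λ where
    (yes b≡0) → headInW (subst (λ c → SamePoint (a , c) (1# , 0#)) (sym b≡0)
                  (onHead a (λ a≡0 → P≢0 (cong₂ _,_ a≡0 b≡0))))
    (no b≢0) → offClub∈L_W a b b≢0 P∉C

  complement∪head-linear : IsF2Linear Complement∪Head
  complement∪head-linear = W , λ P P≢0 → mk⇔ (L_W⊆ P) (⊆L_W P P≢0)

lemma2p14 : (h : ℕ) → 3 ≤ h → (F : Defs.Field) → HasOrder F (2 ^ h) → (λ′ : Field.Carrier F) → IsPrimitive F λ′ → Geometry.IsF2Linear F (Club.Complement∪Head F h λ′)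
lemma2p14 (suc (suc (suc k))) (s≤s (s≤s (s≤s _))) F ord g prim = ClubComplement.complement∪head-linear k F ord g prim
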